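{- Let $n\geqslant 7$ be odd and let $\lambda$ be an integer with $1\leqslant\lambda\leqslant\frac{n-3}{4}$. Then $\left(\frac{n-2\lambda+1}{2},\ \lambda+2,\ 2\times(\lambda-1),\ 1\times\frac{n-4\lambda-1}{2}\right)$ is a partition of $n$ and it corresponds to the eigenvalue $\lambda$ of the Transposition graph $T_n$; in particular $\lambda$ is an eigenvalue of $T_n$.
   Context: The Transposition graph $T_n$ is the Cayley graph on the symmetric group $\mathrm{Sym}_n$ generated by the set of all transpositions. Its eigenvalues (of the adjacency matrix) are indexed by partitions of $n$: to a partition $\mathbf{i}=(n_1,\dots,n_k)\vdash n$ with $n_1\geqslant\dots\geqslant n_k\geqslant 1$ corresponds the eigenvalue $\lambda_{\mathbf i}=\sum_{j=1}^k \frac{n_j(n_j-2j+1)}{2}$ of $T_n$, and every eigenvalue arises this way. "The partition $\mathbf i$ corresponds to the eigenvalue $\lambda$" means $\lambda_{\mathbf i}=\lambda$. The notation $a\times t$ inside a partition means the part $a$ repeated $t$ times ($t\geqslant 0$, so $t=0$ means the part is absent). -}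

module Defs where

open import Data.Nat using (ℕ; zero; suc; _≥_; _≤_)
open import Data.List using (List; []; _∷_)
open import Data.Nat.ListAction using (sum)
open import Data.List.Relation.Unary.All using (All)
open import Data.List.Relation.Unary.Linked using (Linked)
open import Data.Integer as ℤ using (ℤ; +_)
open import Data.Integer.DivMod using (_/ℕ_)
open import Data.Product using (Σ; _×_)
open import Relation.Binary.PropositionalEquality using (_≡_)

IsPartition : ℕ → List ℕ → Set
IsPartition n p = All (λ a → a ≥ 1) p × Linked _≥_ p × sum p ≡ n

-- j-th term (j is 1-based): n_j (n_j - 2j + 1) / 2  (always an exact division)
term : ℕ → ℕ → ℤ
term j a = ((+ a) ℤ.* ((+ a) ℤ.- (+ 2) ℤ.* (+ j) ℤ.+ + 1)) /ℕ 2

eigFrom : ℕ → List ℕ → ℤ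
eigFrom j [] = + 0
eigFrom j (a ∷ p) = term j a ℤ.+ eigFrom (suc j) p

eigenvalueOf : List ℕ → ℤ
eigenvalueOf p = eigFrom 1 p

Corresponds : ℕ → List ℕ → ℤ → Set
Corresponds n p μ = IsPartition n p × eigenvalueOf p ≡ μ

-- μ is an eigenvalue of T_n (eigenvalues of T_n are exactly the μ_i, i ⊢ n)
IsEigenvalueT : ℕ → ℤ → Set
IsEigenvalueT n μ = Σ (List ℕ) (λ p → Corresponds n p μ)

-- Doubling clears the halves in the eigenvalue formula: a block of t equal parts a
-- occupying positions j, …, j + t − 1 contributes t a (a − 2j − t + 2) to 2λ. Writing the
-- odd n as 4λ + 1 + 2c with c ≥ 1, the four blocks (λ + 1 + c), (λ + 2), 2 × (λ − 1),
-- 1 × c of the partition then contribute exactly 2λ in total.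
module Submission where

open import Defs
open import Data.Nat as ℕ using (ℕ; zero; suc; _≤_; _≥_; _∸_; s≤s; z≤n)
import Data.Nat.Properties as ℕP
open import Data.Nat.DivMod using (m≡m%n+[m/n]*n; m*n/n≡m; m*n%n≡0)
open import Data.Nat.ListAction using (sum)
open import Data.Nat.ListAction.Properties using (sum-++)
import Data.Nat.Tactic.RingSolver as ℕSolver
open import Data.List using (List; []; _∷_; _++_; replicate; length)
open import Data.List.Properties using (length-replicate)
open import Data.List.Relation.Unary.All using (All; _∷_)
import Data.List.Relation.Unary.All.Properties as All
open import Data.List.Relation.Unary.Linked using (Linked; [-]; _∷_)
open import Data.Integer using (+_)
open import Data.Product using (∃-syntax; _×_; _,_; proj₁; proj₂)
open import Relation.Binary.PropositionalEquality

module _ where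
  open import Data.Integer using (ℤ; -[1+_]; -_; _+_; _-_; _*_; _/ℕ_)
  import Data.Integer.Properties as ℤP
  import Data.Integer.Tactic.RingSolver as ℤSolver
  open ≡-Reasoning

  n*2/ℕ2≡n : ∀ x → (x * + 2) /ℕ 2 ≡ x
  n*2/ℕ2≡n (+ n) = trans (cong (_/ℕ 2) (sym (ℤP.pos-* n 2))) (cong +_ (m*n/n≡m n 2))
  n*2/ℕ2≡n -[1+ n ] with suc (suc (n ℕ.* 2)) ℕ.% 2 in eq
  ... | zero = cong (λ v → - (+ v)) (m*n/n≡m (suc n) 2)
  ... | suc _ with () ← trans (sym eq) (m*n%n≡0 (suc n) 2)

  triangular : ℕ → ℤ
  triangular zero = + 0
  triangular (suc n) = + n + triangular n

  triangular-*2 : ∀ n → triangular n * + 2 ≡ + n * (+ n - + 1)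
  triangular-*2 zero = refl
  triangular-*2 (suc n) = begin
    (+ n + triangular n) * + 2            ≡⟨ ℤP.*-distribʳ-+ (+ 2) (+ n) (triangular n) ⟩
    + n * + 2 + triangular n * + 2        ≡⟨ cong (λ e → + n * + 2 + e) (triangular-*2 n) ⟩
    + n * + 2 + + n * (+ n - + 1)         ≡⟨ step (+ n) ⟩
    (+ 1 + + n) * ((+ 1 + + n) - + 1)     ∎
    where
    step : ∀ x → x * + 2 + x * (x - + 1) ≡ (+ 1 + x) * ((+ 1 + x) - + 1)
    step = ℤSolver.solve-∀

  -- The division in term is exact: a (a - 2j + 1) = 2 (a (a - 1) / 2 + a (1 - j)).
  term-*2 : ∀ j a → term j a * + 2 ≡ + a * (+ a - + 2 * + j + + 1)
  term-*2 j a = begin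
    term j a * + 2           ≡⟨ cong (λ e → (e /ℕ 2) * + 2) doubled ⟩
    ((x * + 2) /ℕ 2) * + 2   ≡⟨ cong (_* + 2) (n*2/ℕ2≡n x) ⟩
    x * + 2                  ≡⟨ sym doubled ⟩
    + a * (+ a - + 2 * + j + + 1) ∎
    where
    x : ℤ
    x = triangular a + + a * (+ 1 - + j)
    split : ∀ a j → a * (a - + 2 * j + + 1) ≡ a * (a - + 1) + a * (+ 1 - j) * + 2
    split = ℤSolver.solve-∀
    doubled : + a * (+ a - + 2 * + j + + 1) ≡ x * + 2
    doubled = begin
      + a * (+ a - + 2 * + j + + 1)                        ≡⟨ split (+ a) (+ j) ⟩
      + a * (+ a - + 1) + + a * (+ 1 - + j) * + 2          ≡⟨ cong (λ e → e + + a * (+ 1 - + j) * + 2) (sym (triangular-*2 a)) ⟩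
      triangular a * + 2 + + a * (+ 1 - + j) * + 2         ≡⟨ sym (ℤP.*-distribʳ-+ (+ 2) (triangular a) (+ a * (+ 1 - + j))) ⟩
      x * + 2                                              ∎

  eigFrom-++ : ∀ j p q → eigFrom j (p ++ q) ≡ eigFrom j p + eigFrom (length p ℕ.+ j) q
  eigFrom-++ j [] q = sym (ℤP.+-identityˡ (eigFrom j q))
  eigFrom-++ j (a ∷ p) q = begin
    term j a + eigFrom (suc j) (p ++ q)
      ≡⟨ cong (λ e → term j a + e) (eigFrom-++ (suc j) p q) ⟩
    term j a + (eigFrom (suc j) p + eigFrom (length p ℕ.+ suc j) q)
      ≡⟨ sym (ℤP.+-assoc (term j a) (eigFrom (suc j) p) _) ⟩
    term j a + eigFrom (suc j) p + eigFrom (length p ℕ.+ suc j) q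
      ≡⟨ cong (λ i → term j a + eigFrom (suc j) p + eigFrom i q) (ℕP.+-suc (length p) j) ⟩
    term j a + eigFrom (suc j) p + eigFrom (suc (length p) ℕ.+ j) q ∎

  eigFrom-replicate-*2 : ∀ t j a →
    eigFrom j (replicate t a) * + 2 ≡ + t * + a * (+ a - + 2 * + j - + t + + 2)
  eigFrom-replicate-*2 zero j a = refl
  eigFrom-replicate-*2 (suc t) j a = begin
    (term j a + eigFrom (suc j) (replicate t a)) * + 2
      ≡⟨ ℤP.*-distribʳ-+ (+ 2) (term j a) _ ⟩
    term j a * + 2 + eigFrom (suc j) (replicate t a) * + 2
      ≡⟨ cong₂ _+_ (term-*2 j a) (eigFrom-replicate-*2 t (suc j) a) ⟩
    + a * (+ a - + 2 * + j + + 1) + + t * + a * (+ a - + 2 * (+ 1 + + j) - + t + + 2)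
      ≡⟨ step (+ t) (+ j) (+ a) ⟩
    (+ 1 + + t) * + a * (+ a - + 2 * + j - (+ 1 + + t) + + 2) ∎
    where
    step : ∀ t j a → a * (a - + 2 * j + + 1) + t * a * (a - + 2 * (+ 1 + j) - t + + 2)
                     ≡ (+ 1 + t) * a * (a - + 2 * j - (+ 1 + t) + + 2)
    step = ℤSolver.solve-∀

  spectralPartition : ℕ → ℕ → List ℕ
  spectralPartition l c = (l ℕ.+ 1 ℕ.+ c) ∷ (l ℕ.+ 2)
                          ∷ (replicate (l ∸ 1) 2 ++ replicate c 1)

  eigenvalueOf-spectralPartition : ∀ {l} c → 1 ≤ l → eigenvalueOf (spectralPartition l c) ≡ + l
  eigenvalueOf-spectralPartition {suc l} c (s≤s z≤n) = ℤP.*-cancelʳ-≡ _ _ (+ 2) (begin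
    (term 1 a + (term 2 b + eigFrom 3 (twos ++ ones))) * + 2
      ≡⟨ cong (λ e → (term 1 a + (term 2 b + e)) * + 2) (eigFrom-++ 3 twos ones) ⟩
    (term 1 a + (term 2 b + (eigFrom 3 twos + eigFrom (length twos ℕ.+ 3) ones))) * + 2
      ≡⟨ cong (λ i → (term 1 a + (term 2 b + (eigFrom 3 twos + eigFrom (i ℕ.+ 3) ones))) * + 2)
              (length-replicate l) ⟩
    (term 1 a + (term 2 b + (eigFrom 3 twos + eigFrom (l ℕ.+ 3) ones))) * + 2
      ≡⟨ distrib (term 1 a) (term 2 b) (eigFrom 3 twos) (eigFrom (l ℕ.+ 3) ones) ⟩
    term 1 a * + 2 + term 2 b * + 2 + eigFrom 3 twos * + 2 + eigFrom (l ℕ.+ 3) ones * + 2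
      ≡⟨ cong₂ _+_ (cong₂ _+_ (cong₂ _+_ (term-*2 1 a) (term-*2 2 b))
                              (eigFrom-replicate-*2 l 3 2))
                   (eigFrom-replicate-*2 c (l ℕ.+ 3) 1) ⟩
    _ ≡⟨ closedForm (+ l) (+ c) ⟩
    + suc l * + 2 ∎)
    where
    a b : ℕ
    a = suc l ℕ.+ 1 ℕ.+ c
    b = suc l ℕ.+ 2
    twos ones : List ℕ
    twos = replicate l 2
    ones = replicate c 1
    distrib : ∀ w x y z → (w + (x + (y + z))) * + 2 ≡ w * + 2 + x * + 2 + y * + 2 + z * + 2
    distrib = ℤSolver.solve-∀
    closedForm : ∀ l c →
      let a = + 1 + l + + 1 + c ; b = + 1 + l + + 2 in
      a * (a - + 2 * + 1 + + 1) + b * (b - + 2 * + 2 + + 1)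
        + l * + 2 * (+ 2 - + 2 * + 3 - l + + 2)
        + c * + 1 * (+ 1 - + 2 * (l + + 3) - c + + 2)
        ≡ (+ 1 + l) * + 2
    closedForm = ℤSolver.solve-∀

open import Data.Nat using (_+_; _*_; _/_; _%_)

≥-replicate : ∀ t {a b} → a ≥ b → Linked _≥_ (a ∷ replicate t b)
≥-replicate zero a≥b = [-]
≥-replicate (suc t) a≥b = a≥b ∷ ≥-replicate t ℕP.≤-refl

≥-replicate-++ : ∀ t {a b rest} → a ≥ b → Linked _≥_ (b ∷ rest) → Linked _≥_ (a ∷ replicate t b ++ rest)
≥-replicate-++ zero a≥b [-] = [-]
≥-replicate-++ zero a≥b (b≥c ∷ linked) = ℕP.≤-trans b≥c a≥b ∷ linked
≥-replicate-++ (suc t) a≥b linked = a≥b ∷ ≥-replicate-++ t ℕP.≤-refl linked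

sum-replicate : ∀ t a → sum (replicate t a) ≡ t * a
sum-replicate zero a = refl
sum-replicate (suc t) a = cong (λ s → a + s) (sum-replicate t a)

spectralPartition-isPartition : ∀ {l c} → 1 ≤ l → 1 ≤ c →
  IsPartition (4 * l + 1 + 2 * c) (spectralPartition l c)
spectralPartition-isPartition {suc l} {c} (s≤s z≤n) 1≤c = positive , nonIncreasing , total
  where
  positive : All (_≥ 1) (spectralPartition (suc l) c)
  positive = s≤s z≤n ∷ s≤s z≤n ∷ All.++⁺ (All.replicate⁺ l (s≤s z≤n)) (All.replicate⁺ c ℕP.≤-refl)
  a≥b : suc l + 1 + c ≥ suc l + 2
  a≥b = ℕP.≤-trans (ℕP.≤-reflexive (sym (ℕP.+-assoc (suc l) 1 1))) (ℕP.+-monoʳ-≤ (suc l + 1) 1≤c)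
  nonIncreasing : Linked _≥_ (spectralPartition (suc l) c)
  nonIncreasing = a≥b ∷ ≥-replicate-++ l (ℕP.m≤n+m 2 (suc l)) (≥-replicate c (s≤s z≤n))
  total : sum (spectralPartition (suc l) c) ≡ 4 * suc l + 1 + 2 * c
  total = begin
    suc l + 1 + c + (suc l + 2 + sum (replicate l 2 ++ replicate c 1))
      ≡⟨ cong (λ s → suc l + 1 + c + (suc l + 2 + s))
              (trans (sum-++ (replicate l 2) _) (cong₂ _+_ (sum-replicate l 2) (sum-replicate c 1))) ⟩
    suc l + 1 + c + (suc l + 2 + (l * 2 + c * 1))
      ≡⟨ count l c ⟩
    4 * suc l + 1 + 2 * c ∎
    where
    open ≡-Reasoning
    count : ∀ l c → suc l + 1 + c + (suc l + 2 + (l * 2 + c * 1)) ≡ 4 * suc l + 1 + 2 * c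
    count = ℕSolver.solve-∀

odd-split : ∀ {n l} → n % 2 ≡ 1 → 4 * l + 3 ≤ n → ∃[ c ] 1 ≤ c × n ≡ 4 * l + 1 + 2 * c
odd-split {n} {l} odd bound = suc k , s≤s z≤n , (begin
    n                           ≡⟨ n≡1+m*2 ⟩
    1 + m * 2                   ≡⟨ cong (λ x → 1 + x * 2) (sym 2l+1+k≡m) ⟩
    1 + (2 * l + 1 + k) * 2     ≡⟨ regroup l k ⟩
    4 * l + 1 + 2 * suc k       ∎)
  where
  open ≡-Reasoning
  m : ℕ
  m = n / 2
  n≡1+m*2 : n ≡ 1 + m * 2
  n≡1+m*2 = trans (m≡m%n+[m/n]*n n 2) (cong (_+ m * 2) odd)
  shift : ∀ l → 4 * l + 3 ≡ suc ((2 * l + 1) * 2)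
  shift = ℕSolver.solve-∀
  2l+1≤m : 2 * l + 1 ≤ m
  2l+1≤m = ℕP.*-cancelʳ-≤ _ _ 2 (ℕ.s≤s⁻¹ (subst₂ _≤_ (shift l) n≡1+m*2 bound))
  k : ℕ
  k = proj₁ (ℕP.m≤n⇒∃[o]m+o≡n 2l+1≤m)
  2l+1+k≡m : 2 * l + 1 + k ≡ m
  2l+1+k≡m = proj₂ (ℕP.m≤n⇒∃[o]m+o≡n 2l+1≤m)
  regroup : ∀ l k → 1 + (2 * l + 1 + k) * 2 ≡ 4 * l + 1 + 2 * suc k
  regroup = ℕSolver.solve-∀

largestPart : ∀ l c → (4 * l + 1 + 2 * c ∸ 2 * l + 1) / 2 ≡ l + 1 + c
largestPart l c = begin
  (4 * l + 1 + 2 * c ∸ 2 * l + 1) / 2           ≡⟨ cong (λ x → (x ∸ 2 * l + 1) / 2) (split l c) ⟩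
  (2 * l + (2 * l + 1 + 2 * c) ∸ 2 * l + 1) / 2 ≡⟨ cong (λ x → (x + 1) / 2) (ℕP.m+n∸m≡n (2 * l) _) ⟩
  (2 * l + 1 + 2 * c + 1) / 2                   ≡⟨ cong (_/ 2) (double l c) ⟩
  (l + 1 + c) * 2 / 2                           ≡⟨ m*n/n≡m (l + 1 + c) 2 ⟩
  l + 1 + c                                     ∎
  where
  open ≡-Reasoning
  split : ∀ l c → 4 * l + 1 + 2 * c ≡ 2 * l + (2 * l + 1 + 2 * c)
  split = ℕSolver.solve-∀
  double : ∀ l c → 2 * l + 1 + 2 * c + 1 ≡ (l + 1 + c) * 2
  double = ℕSolver.solve-∀

numberOfOnes : ∀ l c → (4 * l + 1 + 2 * c ∸ 4 * l ∸ 1) / 2 ≡ c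
numberOfOnes l c = begin
  (4 * l + 1 + 2 * c ∸ 4 * l ∸ 1) / 2     ≡⟨ cong (λ x → (x ∸ 4 * l ∸ 1) / 2) (ℕP.+-assoc (4 * l) 1 (2 * c)) ⟩
  (4 * l + (1 + 2 * c) ∸ 4 * l ∸ 1) / 2   ≡⟨ cong (λ x → (x ∸ 1) / 2) (ℕP.m+n∸m≡n (4 * l) (1 + 2 * c)) ⟩
  2 * c / 2                               ≡⟨ cong (_/ 2) (ℕP.*-comm 2 c) ⟩
  c * 2 / 2                               ≡⟨ m*n/n≡m c 2 ⟩
  c                                       ∎
  where open ≡-Reasoning

lemma3 : (n l : ℕ) → n % 2 ≡ 1 → 7 ≤ n → 1 ≤ l → 4 * l ≤ n ∸ 3 →
    Corresponds n (((n ∸ 2 * l) + 1) / 2 ∷ (l + 2) ∷ (replicate (l ∸ 1) 2 ++ replicate ((n ∸ 4 * l ∸ 1) / 2) 1)) (+ l)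
    × IsEigenvalueT n (+ l)
lemma3 n l odd 7≤n 1≤l 4l≤n∸3
  with c , 1≤c , refl ← odd-split {l = l} odd
                          (ℕP.m≤o∸n⇒m+n≤o (4 * l) (ℕP.≤-trans (ℕP.m≤m+n 3 4) 7≤n) 4l≤n∸3)
  rewrite largestPart l c | numberOfOnes l c
  = corresponds , spectralPartition l c , corresponds
  where
  corresponds : Corresponds (4 * l + 1 + 2 * c) (spectralPartition l c) (+ l)
  corresponds = spectralPartition-isPartition 1≤l 1≤c
              , eigenvalueOf-spectralPartition c 1≤l
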